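{- According to relative interval analysis, $l(\mathrm{Maj},\mathrm{Eag})=[-\frac12,1]$, i.e., $\mathrm{Min}(\mathrm{Maj},\mathrm{Eag})=-\frac12$ and $\mathrm{Max}(\mathrm{Maj},\mathrm{Eag})=1$.
   Context: Online frequent items problem: an input sequence is $I=a_1,\ldots,a_n$ of items from an infinite universe, $n=|I|$. An algorithm maintains a buffer holding one item; $s_t$ is the buffer content after step $t$; at step $1$ the buffer receives $a_1$, and at each later step $t$ the algorithm either keeps $s_{t-1}$ or replaces it by $a_t$. With $f_I(a)=|\{i:a_i=a\}|/n$, the aggregate frequency of $\mathcal A$ on $I$ is $\mathcal A(I)=\sum_{t=1}^n f_I(s^{\mathcal A}_t)$. Maj keeps a counter, initially $0$: when an item arrives, if the counter is $0$ it buffers the item and sets the counter to $1$; otherwise, if the arriving item equals the buffered item the counter is incremented, else it is decremented (buffer unchanged). Eag: let $t^*=\min\{t\in\{1,\ldots,n-1\}: a_t=a_{t+1}\}$ if such $t$ exists, else $t^*=n$; Eag sets $s_t=a_t$ for $t\le t^*$ and $s_t=a_{t^*}$ for $t>t^*$. Relative interval analysis: $\mathrm{Min}_{\mathcal A,\mathcal B}(n)=\min_{|I|=n}\{\mathcal A(I)-\mathcal B(I)\}$, $\mathrm{Max}_{\mathcal A,\mathcal B}(n)=\max_{|I|=n}\{\mathcal A(I)-\mathcal B(I)\}$, $\mathrm{Min}(\mathcal A,\mathcal B)=\liminf_{n\to\infty}\mathrm{Min}_{\mathcal A,\mathcal B}(n)/n$, $\mathrm{Max}(\mathcal A,\mathcal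 B)=\limsup_{n\to\infty}\mathrm{Max}_{\mathcal A,\mathcal B}(n)/n$, and $l(\mathcal A,\mathcal B)=[\mathrm{Min}(\mathcal A,\mathcal B),\mathrm{Max}(\mathcal A,\mathcal B)]$. -}

module Defs where

open import Data.Nat as ℕ using (ℕ; zero; suc; _≟_)
open import Data.Integer using (+_)
open import Data.List using (List; []; _∷_; length; filter; map; replicate; foldr)
open import Data.Product using (_×_; _,_)
open import Data.Bool using (if_then_else_)
open import Relation.Nullary.Decidable using (does)
open import Data.Rational using (ℚ; 0ℚ; _+_; _-_; _/_; _≤_; Positive; -_; 1ℚ; ½)
open import Relation.Binary.PropositionalEquality using (_≡_)
open import Data.Product using (Σ; ∃-syntax)

Item : Set
Item = ℕ

Input : Set
Input = List Item

count : Item → Input → ℕ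
count a I = length (filter (a ≟_) I)

-- c / n as a rational (0 if n = 0; never used with n = 0 in the statement)
ratio : ℕ → ℕ → ℚ
ratio c zero    = 0ℚ
ratio c (suc m) = (+ c) / suc m

freq : Input → Item → ℚ
freq I a = ratio (count a I) (length I)

sumℚ : List ℚ → ℚ
sumℚ = foldr _+_ 0ℚ

-- An online algorithm is represented by the list of buffer contents s_1 … s_n.
-- Aggregate frequency: A(I) = Σ_t f_I(s_t).
aggregate : (Input → List Item) → Input → ℚ
aggregate alg I = sumℚ (map (freq I) (alg I))

-- Maj: state (buffer, counter); with counter 0 the buffer content is irrelevant
majGo : Item → ℕ → Input → List Item
majGo b c [] = []
majGo b zero (a ∷ as) = a ∷ majGo a 1 as
majGo b (suc c) (a ∷ as) =
  if does (a ≟ b) then b ∷ majGo b (suc (suc c)) as else b ∷ majGo b c as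

Maj : Input → List Item
Maj = majGo 0 0

Eag : Input → List Item
Eag [] = []
Eag (x ∷ []) = x ∷ []
Eag (x ∷ y ∷ rest) =
  if does (x ≟ y) then x ∷ replicate (length (y ∷ rest)) x else x ∷ Eag (y ∷ rest)

scaledDiff : (Input → List Item) → (Input → List Item) → Input → ℚ
scaledDiff A B I = ratio 1 (length I) Data.Rational.* (aggregate A I - aggregate B I)

-- Min(A,B) = L, i.e. liminf_{n→∞} Min_{A,B}(n)/n = L where
-- Min_{A,B}(n) = min_{|I|=n} (A(I) - B(I)).
MinIs : (Input → List Item) → (Input → List Item) → ℚ → Set
MinIs A B L =
  ((ε : ℚ) → Positive ε → ∃[ N ] ((n : ℕ) → N ℕ.≤ n → (I : Input) → length I ≡ n →
      L - ε ≤ scaledDiff A B I))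
  × ((ε : ℚ) → Positive ε → (N : ℕ) → ∃[ n ] (N ℕ.≤ n × ∃[ I ] (length I ≡ n ×
      scaledDiff A B I ≤ L + ε)))

-- Max(A,B) = L, i.e. limsup_{n→∞} Max_{A,B}(n)/n = L where
-- Max_{A,B}(n) = max_{|I|=n} (A(I) - B(I)).
MaxIs : (Input → List Item) → (Input → List Item) → ℚ → Set
MaxIs A B L =
  ((ε : ℚ) → Positive ε → ∃[ N ] ((n : ℕ) → N ℕ.≤ n → (I : Input) → length I ≡ n →
      scaledDiff A B I ≤ L + ε))
  × ((ε : ℚ) → Positive ε → (N : ℕ) → ∃[ n ] (N ℕ.≤ n × ∃[ I ] (length I ≡ n ×
      L - ε ≤ scaledDiff A B I)))

-- Write n·A(I) = Σₜ count(sₜ), so that (A(I) − B(I))/n is a difference of two such sums over n².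
-- Since every count is at most n, the Maj sum is at most n², giving the upper bound 1.
-- For the lower bound let x be a most frequent item, with K occurrences.  Every item Eag
-- buffers occurs at most K times, so the Eag sum is at most nK; and the majority-vote
-- guarantee says Maj buffers x in at least 2K − n steps, so the Maj sum is at least (2K − n)K.
-- The difference nK − (2K − n)K is at most n²/2 because (n − 2K)² ≥ 0.
-- Both bounds are approached: on 1 1 0 0 0 … Eag keeps the rare item 1 while Maj turns to 0,
-- and on 0 0 1 2 3 0 4 0 5 0 … Eag keeps 0 while Maj keeps buffering singletons.
module Submission where

open import Defs
open import Data.Product using (_×_)
open import Data.Rational using (-_; ½; 1ℚ)
open import Data.Bool using (true; false)
open import Data.Integer as ℤ using (+_; +[1+_]; -[1+_])
import Data.Integer.Properties as ℤP
import Data.Integer.Tactic.RingSolver as ℤ-Solver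
open import Data.List using (List; []; _∷_; length; map; filter; replicate)
import Data.List.Properties as List
open import Data.List.Extrema.Nat using (argmax; f[xs]≤f[argmax])
open import Data.List.Membership.Propositional using (_∈_)
open import Data.List.Relation.Unary.All using (lookup)
open import Data.List.Relation.Unary.Any using (here; there)
open import Data.Nat as ℕ using (ℕ; zero; suc; _≟_; _+_; _*_; _≤_; z≤n; s≤s)
open import Data.Nat.ListAction using (sum)
open import Data.Nat.Properties
import Data.Nat.Tactic.RingSolver as ℕ-Solver
open import Data.Product using (_,_; ∃-syntax)
open import Data.Rational as ℚ using (ℚ; mkℚ; _/_; toℚᵘ; Positive)
import Data.Rational.Properties as ℚP
open import Data.Rational.Unnormalised as ℚᵘ using (mkℚᵘ; *≡*; *≤*)
import Data.Rational.Unnormalised.Properties as ℚᵘP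
open import Data.Sum using (_⊎_; inj₁; inj₂)
open import Relation.Nullary using (yes; no; does; ¬?)
open import Relation.Nullary.Decidable using (dec-true; dec-false)
open import Relation.Binary.PropositionalEquality
open import Function using (_∘_)

countSum : Input → List Item → ℕ
countSum I L = sum (map (λ s → count s I) L)

others : Item → Input → ℕ
others x I = length (filter (λ y → ¬? (x ≟ y)) I)

count-≡ : ∀ {x a} as → x ≡ a → count x (a ∷ as) ≡ suc (count x as)
count-≡ as x≡a = cong length (List.filter-accept (_ ≟_) x≡a)

count-≢ : ∀ {x a} as → x ≢ a → count x (a ∷ as) ≡ count x as
count-≢ as x≢a = cong length (List.filter-reject (_ ≟_) x≢a)

others-≡ : ∀ {x a} as → x ≡ a → others x (a ∷ as) ≡ others x as
others-≡ {x} as x≡a = cong length (List.filter-reject (λ y → ¬? (x ≟ y)) (λ x≢a → x≢a x≡a))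

others-≢ : ∀ {x a} as → x ≢ a → others x (a ∷ as) ≡ suc (others x as)
others-≢ {x} as x≢a = cong length (List.filter-accept (λ y → ¬? (x ≟ y)) x≢a)

count+others≡length : ∀ x I → count x I + others x I ≡ length I
count+others≡length x [] = refl
count+others≡length x (a ∷ as) with x ≟ a
... | yes x≡a rewrite count-≡ as x≡a | others-≡ as x≡a = cong suc (count+others≡length x as)
... | no  x≢a rewrite count-≢ as x≢a | others-≢ as x≢a =
  trans (+-suc (count x as) _) (cong suc (count+others≡length x as))

count≤length : ∀ x I → count x I ≤ length I
count≤length x = List.length-filter (x ≟_)

count≡0⊎∈ : ∀ y I → count y I ≡ 0 ⊎ y ∈ I
count≡0⊎∈ y [] = inj₁ refl
count≡0⊎∈ y (a ∷ as) with y ≟ a | count≡0⊎∈ y as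
... | yes y≡a | _         = inj₂ (here y≡a)
... | no  y≢a | inj₁ c≡0  = inj₁ (trans (count-≢ as y≢a) c≡0)
... | no  _   | inj₂ y∈as = inj₂ (there y∈as)

mode : Input → Item
mode I = argmax (λ a → count a I) 0 I

count≤count-mode : ∀ I y → count y I ≤ count (mode I) I
count≤count-mode I y with count≡0⊎∈ y I
... | inj₁ c≡0 = subst (_≤ _) (sym c≡0) z≤n
... | inj₂ y∈I = lookup (f[xs]≤f[argmax] 0 I) y∈I

countSum≤length*bound : ∀ I K → (∀ y → count y I ≤ K) → ∀ L → countSum I L ≤ length L * K
countSum≤length*bound I K bound [] = z≤n
countSum≤length*bound I K bound (a ∷ L) = +-mono-≤ (bound a) (countSum≤length*bound I K bound L)

count*count≤countSum : ∀ I x L → count x L * count x I ≤ countSum I L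
count*count≤countSum I x [] = z≤n
count*count≤countSum I x (a ∷ L) with x ≟ a
... | yes refl rewrite count-≡ L (refl {x = x}) = +-monoʳ-≤ (count x I) (count*count≤countSum I x L)
... | no  x≢a  rewrite count-≢ L x≢a = ≤-trans (count*count≤countSum I x L) (m≤n+m _ (count a I))

countSum-replicate : ∀ I k a → countSum I (replicate k a) ≡ k * count a I
countSum-replicate I zero    a = refl
countSum-replicate I (suc k) a = cong (λ s → count a I + s) (countSum-replicate I k a)

length-majGo : ∀ b c I → length (majGo b c I) ≡ length I
length-majGo b c [] = refl
length-majGo b zero (a ∷ I) = cong suc (length-majGo a 1 I)
length-majGo b (suc c) (a ∷ I) with does (a ≟ b)
... | true  = cong suc (length-majGo b (suc (suc c)) I)
... | false = cong suc (length-majGo b c I)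

length-Eag : ∀ I → length (Eag I) ≡ length I
length-Eag [] = refl
length-Eag (x ∷ []) = refl
length-Eag (x ∷ y ∷ r) with ih ← length-Eag (y ∷ r) | does (x ≟ y)
... | true  = cong suc (List.length-replicate (length (y ∷ r)))
... | false = cong suc ih

majGo-≡ : ∀ {a b} c as → a ≡ b → majGo b (suc c) (a ∷ as) ≡ b ∷ majGo b (suc (suc c)) as
majGo-≡ {a} {b} c as a≡b rewrite dec-true (a ≟ b) a≡b = refl

majGo-≢ : ∀ {a b} c as → a ≢ b → majGo b (suc c) (a ∷ as) ≡ b ∷ majGo b c as
majGo-≢ {a} {b} c as a≢b rewrite dec-false (a ≟ b) a≢b = refl

-- The majority guarantee

count≤majGo-holding : ∀ x c I → count x I ≤ count x (majGo x c I) + others x I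
-- A rival b held with counter c can still absorb c occurrences of x: that is the slack c.
count≤majGo-rival : ∀ {x b} c I → x ≢ b → count x I ≤ count x (majGo b c I) + (c + others x I)

count≤majGo-holding x c [] = z≤n
count≤majGo-holding x zero (a ∷ as) with x ≟ a
... | yes refl rewrite count-≡ as (refl {x = x}) | count-≡ (majGo x 1 as) (refl {x = x})
                     | others-≡ as (refl {x = x}) =
  s≤s (count≤majGo-holding x 1 as)
... | no  x≢a rewrite count-≢ as x≢a | count-≢ (majGo a 1 as) x≢a | others-≢ as x≢a =
  count≤majGo-rival 1 as x≢a
count≤majGo-holding x (suc c) (a ∷ as) with a ≟ x
... | yes refl rewrite majGo-≡ c as (refl {x = x}) | count-≡ as (refl {x = x})
                     | count-≡ (majGo x (suc (suc c)) as) (refl {x = x}) | others-≡ as (refl {x = x}) =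
  s≤s (count≤majGo-holding x (suc (suc c)) as)
... | no  a≢x rewrite majGo-≢ c as a≢x | count-≢ as (a≢x ∘ sym)
                     | count-≡ (majGo x c as) (refl {x = x}) | others-≢ as (a≢x ∘ sym) =
  ≤-trans (count≤majGo-holding x c as) (m≤n⇒m≤1+n (+-monoʳ-≤ _ (n≤1+n _)))

count≤majGo-rival zero [] x≢b = z≤n
count≤majGo-rival {x} zero (a ∷ as) x≢b = count≤majGo-holding x 0 (a ∷ as)
count≤majGo-rival (suc c) [] x≢b = z≤n
count≤majGo-rival {x} {b} (suc c) (a ∷ as) x≢b with a ≟ b
... | yes refl rewrite majGo-≡ c as (refl {x = b}) | count-≢ as x≢b
                     | count-≢ (majGo b (suc (suc c)) as) x≢b | others-≢ as x≢b =
  subst (λ r → count x as ≤ count x (majGo b (suc (suc c)) as) + r) (sym (+-suc (suc c) (others x as)))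
    (count≤majGo-rival (suc (suc c)) as x≢b)
... | no  a≢b rewrite majGo-≢ c as a≢b | count-≢ (majGo b c as) x≢b with x ≟ a
...   | yes refl rewrite count-≡ as (refl {x = x}) | others-≡ as (refl {x = x}) =
  subst (suc (count x as) ≤_) (sym (+-suc (count x (majGo b c as)) (c + others x as)))
    (s≤s (count≤majGo-rival c as x≢b))
...   | no  x≢a rewrite count-≢ as x≢a | others-≢ as x≢a =
  ≤-trans (count≤majGo-rival c as x≢b) (+-monoʳ-≤ _ (+-mono-≤ (n≤1+n c) (n≤1+n _)))

count≤count-Maj+others : ∀ x I → count x I ≤ count x (Maj I) + others x I
count≤count-Maj+others x [] = z≤n
count≤count-Maj+others x (a ∷ as) = count≤majGo-holding x 0 (a ∷ as)

count+count≤count-Maj+length : ∀ x I → count x I + count x I ≤ count x (Maj I) + length I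
count+count≤count-Maj+length x I = begin
  k + k        ≤⟨ +-monoˡ-≤ k (count≤count-Maj+others x I) ⟩
  h + o + k    ≡⟨ +-assoc h o k ⟩
  h + (o + k)  ≡⟨ cong (λ m → h + m) (trans (+-comm o k) (count+others≡length x I)) ⟩
  h + length I ∎
  where
  open ≤-Reasoning
  k = count x I
  h = count x (Maj I)
  o = others x I

n*d≤n*n+h*d : ∀ {n d h} → d ≤ h + n → n * d ≤ n * n + h * d
n*d≤n*n+h*d {n} {d} {h} d≤h+n with ≤-total d n
... | inj₁ d≤n = ≤-trans (*-monoʳ-≤ n d≤n) (m≤m+n (n * n) (h * d))
... | inj₂ n≤d with m≤n⇒∃[o]m+o≡n n≤d
...   | e , refl = begin
  n * (n + e)          ≡⟨ *-distribˡ-+ n n e ⟩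
  n * n + n * e        ≤⟨ +-monoʳ-≤ (n * n) (*-monoˡ-≤ e n≤d) ⟩
  n * n + (n + e) * e  ≡⟨ cong (λ m → n * n + m) (*-comm (n + e) e) ⟩
  n * n + e * (n + e)  ≤⟨ +-monoʳ-≤ (n * n) (*-monoˡ-≤ (n + e) e≤h) ⟩
  n * n + h * (n + e)  ∎
  where
  open ≤-Reasoning
  e≤h : e ≤ h
  e≤h = +-cancelʳ-≤ n e h (subst (_≤ h + n) (+-comm n e) d≤h+n)

countSum-Eag≤countSum-Maj : ∀ I → countSum I (Eag I) * 2 ≤ countSum I (Maj I) * 2 + length I * length I
countSum-Eag≤countSum-Maj I = begin
  countSum I (Eag I) * 2   ≤⟨ *-monoˡ-≤ 2 (countSum≤length*bound I k (count≤count-mode I) (Eag I)) ⟩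
  length (Eag I) * k * 2   ≡⟨ cong (λ l → l * k * 2) (length-Eag I) ⟩
  n * k * 2                ≡⟨ regroup n k ⟩
  n * (k + k)              ≤⟨ n*d≤n*n+h*d {n} {k + k} {h} (count+count≤count-Maj+length x I) ⟩
  n * n + h * (k + k)      ≡⟨ cong (λ m → n * n + m) (regroup h k) ⟨
  n * n + h * k * 2        ≤⟨ +-monoʳ-≤ (n * n) (*-monoˡ-≤ 2 (count*count≤countSum I x (Maj I))) ⟩
  n * n + countSum I (Maj I) * 2 ≡⟨ +-comm (n * n) _ ⟩
  countSum I (Maj I) * 2 + n * n ∎
  where
  open ≤-Reasoning
  x = mode I
  k = count x I
  h = count x (Maj I)
  n = length I
  regroup : ∀ m k → m * k * 2 ≡ m * (k + k)
  regroup = ℕ-Solver.solve-∀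

countSum-Maj≤square : ∀ I → countSum I (Maj I) ≤ length I * length I
countSum-Maj≤square I = subst (λ l → countSum I (Maj I) ≤ l * length I) (length-majGo 0 0 I)
  (countSum≤length*bound I (length I) (λ y → count≤length y I) (Maj I))

-- Identities between normalised fractions are proved in ℚᵘ, where they become ring identities in ℤ.

toℚᵘ-/ : ∀ i m → toℚᵘ (i / suc m) ℚᵘ.≃ mkℚᵘ i m
toℚᵘ-/ i m = ℚP.toℚᵘ-fromℚᵘ (mkℚᵘ i m)

/-mono-≤ : ∀ {i j m n} → i ℤ.* + suc n ℤ.≤ j ℤ.* + suc m → i / suc m ℚ.≤ j / suc n
/-mono-≤ {i} {j} {m} {n} h = ℚP.toℚᵘ-cancel-≤
  (ℚᵘP.≤-respˡ-≃ (ℚᵘP.≃-sym (toℚᵘ-/ i m)) (ℚᵘP.≤-respʳ-≃ (ℚᵘP.≃-sym (toℚᵘ-/ j n)) (*≤* h)))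

-- The hypothesis is the cross-multiplied inequality with both sides moved so that it lives in ℕ.
[a-b]/m≤[c-d]/n : ∀ a b c d {m n} → a * suc n + d * suc m ≤ c * suc m + b * suc n →
                  (+ a ℤ.- + b) / suc m ℚ.≤ (+ c ℤ.- + d) / suc n
[a-b]/m≤[c-d]/n a b c d {m} {n} h = /-mono-≤ {+ a ℤ.- + b} {+ c ℤ.- + d} {m} {n} (begin
  (+ a ℤ.- + b) ℤ.* s                          ≡⟨ shift (+ a) (+ b) (+ d) s t ⟩
  (+ a ℤ.* s ℤ.+ + d ℤ.* t) ℤ.- (+ b ℤ.* s ℤ.+ + d ℤ.* t) ≤⟨ ℤP.+-monoˡ-≤ _ h′ ⟩
  (+ c ℤ.* t ℤ.+ + b ℤ.* s) ℤ.- (+ b ℤ.* s ℤ.+ + d ℤ.* t) ≡⟨ unshift (+ c) (+ b) (+ d) s t ⟩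
  (+ c ℤ.- + d) ℤ.* t                          ∎)
  where
  open ℤP.≤-Reasoning
  s = + suc n
  t = + suc m
  cast : ∀ p q r u → + (p * q + r * u) ≡ + p ℤ.* + q ℤ.+ + r ℤ.* + u
  cast p q r u = trans (ℤP.pos-+ (p * q) (r * u)) (cong₂ ℤ._+_ (ℤP.pos-* p q) (ℤP.pos-* r u))
  h′ : + a ℤ.* s ℤ.+ + d ℤ.* t ℤ.≤ + c ℤ.* t ℤ.+ + b ℤ.* s
  h′ = subst₂ ℤ._≤_ (cast a (suc n) d (suc m)) (cast c (suc m) b (suc n)) (ℤ.+≤+ h)
  shift : ∀ a b d s t → (a ℤ.- b) ℤ.* s ≡ (a ℤ.* s ℤ.+ d ℤ.* t) ℤ.- (b ℤ.* s ℤ.+ d ℤ.* t)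
  shift = ℤ-Solver.solve-∀
  unshift : ∀ c b d s t → (c ℤ.* t ℤ.+ b ℤ.* s) ℤ.- (b ℤ.* s ℤ.+ d ℤ.* t) ≡ (c ℤ.- d) ℤ.* t
  unshift = ℤ-Solver.solve-∀

/-+-/ : ∀ i j m → i / suc m ℚ.+ j / suc m ≡ (i ℤ.+ j) / suc m
/-+-/ i j m = ℚP.toℚᵘ-injective (begin
  toℚᵘ (i / suc m ℚ.+ j / suc m)          ≈⟨ ℚP.toℚᵘ-homo-+ (i / suc m) (j / suc m) ⟩
  toℚᵘ (i / suc m) ℚᵘ.+ toℚᵘ (j / suc m)  ≈⟨ ℚᵘP.+-cong (toℚᵘ-/ i m) (toℚᵘ-/ j m) ⟩
  mkℚᵘ i m ℚᵘ.+ mkℚᵘ j m                   ≈⟨ *≡* (identity i j (+ suc m)) ⟩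
  mkℚᵘ (i ℤ.+ j) m                         ≈⟨ toℚᵘ-/ (i ℤ.+ j) m ⟨
  toℚᵘ ((i ℤ.+ j) / suc m)                 ∎)
  where
  open ℚᵘP.≃-Reasoning
  identity : ∀ i j d → (i ℤ.* d ℤ.+ j ℤ.* d) ℤ.* d ≡ (i ℤ.+ j) ℤ.* (d ℤ.* d)
  identity = ℤ-Solver.solve-∀

1/n*[i/n-j/n]≡[i-j]/n*n : ∀ i j m →
  + 1 / suc m ℚ.* (i / suc m ℚ.- j / suc m) ≡ (i ℤ.- j) / (suc m * suc m)
1/n*[i/n-j/n]≡[i-j]/n*n i j m = ℚP.toℚᵘ-injective (begin
  toℚᵘ (e ℚ.* (p ℚ.- q))                      ≈⟨ ℚP.toℚᵘ-homo-* e (p ℚ.- q) ⟩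
  toℚᵘ e ℚᵘ.* toℚᵘ (p ℚ.+ ℚ.- q)             ≈⟨ ℚᵘP.*-congˡ {toℚᵘ e} (ℚP.toℚᵘ-homo-+ p (ℚ.- q)) ⟩
  toℚᵘ e ℚᵘ.* (toℚᵘ p ℚᵘ.+ toℚᵘ (ℚ.- q))     ≈⟨ ℚᵘP.*-congˡ {toℚᵘ e} (ℚᵘP.+-congʳ (toℚᵘ p) (ℚP.toℚᵘ-homo‿- q)) ⟩
  toℚᵘ e ℚᵘ.* (toℚᵘ p ℚᵘ.- toℚᵘ q)           ≈⟨ ℚᵘP.*-cong (toℚᵘ-/ (+ 1) m) (ℚᵘP.+-cong (toℚᵘ-/ i m) (ℚᵘP.-‿cong (toℚᵘ-/ j m))) ⟩
  mkℚᵘ (+ 1) m ℚᵘ.* (mkℚᵘ i m ℚᵘ.- mkℚᵘ j m)  ≈⟨ *≡* (identity i j (+ suc m)) ⟩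
  mkℚᵘ (i ℤ.- j) (m + m * suc m)              ≈⟨ toℚᵘ-/ (i ℤ.- j) (m + m * suc m) ⟨
  toℚᵘ ((i ℤ.- j) / (suc m * suc m))          ∎)
  where
  open ℚᵘP.≃-Reasoning
  e = + 1 / suc m
  p = i / suc m
  q = j / suc m
  identity : ∀ i j d → (+ 1 ℤ.* (i ℤ.* d ℤ.+ ℤ.- j ℤ.* d)) ℤ.* (d ℤ.* d) ≡ (i ℤ.- j) ℤ.* (d ℤ.* (d ℤ.* d))
  identity = ℤ-Solver.solve-∀

1-1/n≡[n-1]/n : ∀ b → 1ℚ ℚ.- + 1 / suc b ≡ (+ b ℤ.- + 0) / suc b
1-1/n≡[n-1]/n b = ℚP.toℚᵘ-injective (begin
  toℚᵘ (1ℚ ℚ.+ ℚ.- p)                  ≈⟨ ℚP.toℚᵘ-homo-+ 1ℚ (ℚ.- p) ⟩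
  toℚᵘ 1ℚ ℚᵘ.+ toℚᵘ (ℚ.- p)           ≈⟨ ℚᵘP.+-congʳ (toℚᵘ 1ℚ) (ℚP.toℚᵘ-homo‿- p) ⟩
  toℚᵘ 1ℚ ℚᵘ.- toℚᵘ p                 ≈⟨ ℚᵘP.+-congʳ (toℚᵘ 1ℚ) (ℚᵘP.-‿cong (toℚᵘ-/ (+ 1) b)) ⟩
  mkℚᵘ (+ 1) 0 ℚᵘ.- mkℚᵘ (+ 1) b       ≈⟨ *≡* (identity (+ b)) ⟩
  mkℚᵘ (+ b ℤ.- + 0) b                 ≈⟨ toℚᵘ-/ (+ b ℤ.- + 0) b ⟨
  toℚᵘ ((+ b ℤ.- + 0) / suc b)         ∎)
  where
  open ℚᵘP.≃-Reasoning
  p = + 1 / suc b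
  identity : ∀ x → (+ 1 ℤ.* (+ 1 ℤ.+ x) ℤ.+ ℤ.- + 1 ℤ.* + 1) ℤ.* (+ 1 ℤ.+ x)
                   ≡ (x ℤ.- + 0) ℤ.* (+ 1 ℤ.* (+ 1 ℤ.+ x))
  identity = ℤ-Solver.solve-∀

-½+1/n≡[2-n]/2n : ∀ b → - ½ ℚ.+ + 1 / suc b ≡ (+ 2 ℤ.- + suc b) / (suc b * 2)
-½+1/n≡[2-n]/2n b = ℚP.toℚᵘ-injective (begin
  toℚᵘ (- ½ ℚ.+ p)                      ≈⟨ ℚP.toℚᵘ-homo-+ (- ½) p ⟩
  toℚᵘ (- ½) ℚᵘ.+ toℚᵘ p               ≈⟨ ℚᵘP.+-congʳ (toℚᵘ (- ½)) (toℚᵘ-/ (+ 1) b) ⟩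
  mkℚᵘ -[1+ 0 ] 1 ℚᵘ.+ mkℚᵘ (+ 1) b     ≈⟨ *≡* (identity (+ suc b)) ⟩
  mkℚᵘ (+ 2 ℤ.- + suc b) (suc (b * 2))  ≈⟨ toℚᵘ-/ (+ 2 ℤ.- + suc b) (suc (b * 2)) ⟨
  toℚᵘ ((+ 2 ℤ.- + suc b) / (suc b * 2)) ∎)
  where
  open ℚᵘP.≃-Reasoning
  p = + 1 / suc b
  identity : ∀ n → (-[1+ 0 ] ℤ.* n ℤ.+ + 1 ℤ.* + 2) ℤ.* (n ℤ.* + 2) ≡ (+ 2 ℤ.- n) ℤ.* (+ 2 ℤ.* n)
  identity = ℤ-Solver.solve-∀

positive⇒1/n≤ : ∀ ε → Positive ε → ∃[ b ] (+ 1 / suc b ℚ.≤ ε)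
positive⇒1/n≤ (mkℚ +[1+ a ] b _) _ =
  b , ℚP.toℚᵘ-cancel-≤ (ℚᵘP.≤-respˡ-≃ (ℚᵘP.≃-sym (toℚᵘ-/ (+ 1) b)) (*≤* (begin
  + 1 ℤ.* + suc b  ≡⟨ ℤP.*-identityˡ (+ suc b) ⟩
  + suc b          ≤⟨ ℤ.+≤+ (m≤n*m (suc b) (suc a)) ⟩
  + (suc a * suc b) ≡⟨ ℤP.pos-* (suc a) (suc b) ⟩
  +[1+ a ] ℤ.* + suc b ∎)))
  where open ℤP.≤-Reasoning

sumℚ-freq : ∀ I {m} → length I ≡ suc m → ∀ L → sumℚ (map (freq I) L) ≡ + countSum I L / suc m
sumℚ-freq I {m} eq [] = sym (ℚP.0/n≡0 (suc m))
sumℚ-freq I {m} eq (a ∷ L) = begin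
  freq I a ℚ.+ sumℚ (map (freq I) L)              ≡⟨ cong₂ ℚ._+_ (cong (ratio (count a I)) eq) (sumℚ-freq I eq L) ⟩
  + count a I / suc m ℚ.+ + countSum I L / suc m  ≡⟨ /-+-/ (+ count a I) (+ countSum I L) m ⟩
  + countSum I (a ∷ L) / suc m                    ∎
  where open ≡-Reasoning

scaledDiff≡ : ∀ A B I {m} → length I ≡ suc m →
  scaledDiff A B I ≡ (+ countSum I (A I) ℤ.- + countSum I (B I)) / (suc m * suc m)
scaledDiff≡ A B I {m} eq = begin
  ratio 1 (length I) ℚ.* (aggregate A I ℚ.- aggregate B I)
    ≡⟨ cong₂ (λ r s → r ℚ.* s) (cong (ratio 1) eq) (cong₂ ℚ._-_ (sumℚ-freq I eq (A I)) (sumℚ-freq I eq (B I))) ⟩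
  + 1 / suc m ℚ.* (+ countSum I (A I) / suc m ℚ.- + countSum I (B I) / suc m)
    ≡⟨ 1/n*[i/n-j/n]≡[i-j]/n*n (+ countSum I (A I)) (+ countSum I (B I)) m ⟩
  (+ countSum I (A I) ℤ.- + countSum I (B I)) / (suc m * suc m) ∎
  where open ≡-Reasoning

-½≤scaledDiff-Maj-Eag : ∀ a as → - ½ ℚ.≤ scaledDiff Maj Eag (a ∷ as)
-½≤scaledDiff-Maj-Eag a as = begin
  (+ 0 ℤ.- + 1) / 2          ≤⟨ [a-b]/m≤[c-d]/n 0 1 sm se (subst (λ r → se * 2 ≤ sm * 2 + r) (sym (*-identityˡ nn))
                                                 (countSum-Eag≤countSum-Maj I)) ⟩
  (+ sm ℤ.- + se) / nn       ≡⟨ scaledDiff≡ Maj Eag I refl ⟨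
  scaledDiff Maj Eag I       ∎
  where
  open ℚP.≤-Reasoning
  I = a ∷ as
  sm = countSum I (Maj I)
  se = countSum I (Eag I)
  nn = length I * length I

scaledDiff-Maj-Eag≤1 : ∀ a as → scaledDiff Maj Eag (a ∷ as) ℚ.≤ 1ℚ
scaledDiff-Maj-Eag≤1 a as = begin
  scaledDiff Maj Eag I       ≡⟨ scaledDiff≡ Maj Eag I refl ⟩
  (+ sm ℤ.- + se) / nn       ≤⟨ [a-b]/m≤[c-d]/n sm se 1 0 (subst₂ _≤_ (sym (drop-units sm nn)) (pad-units nn se)
                                  (≤-trans (countSum-Maj≤square I) (m≤m+n nn se))) ⟩
  (+ 1 ℤ.- + 0) / 1          ∎
  where
  open ℚP.≤-Reasoning
  I = a ∷ as
  sm = countSum I (Maj I)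
  se = countSum I (Eag I)
  nn = length I * length I
  drop-units : ∀ x y → x * 1 + 0 * y ≡ x
  drop-units = ℕ-Solver.solve-∀
  pad-units : ∀ x y → x + y ≡ 1 * x + y * 1
  pad-units = ℕ-Solver.solve-∀

-- Inputs on which the bounds are attained

count-replicate-0 : ∀ k → count 0 (replicate k 0) ≡ k
count-replicate-0 zero    = refl
count-replicate-0 (suc k) = cong suc (count-replicate-0 k)

count-suc-replicate-0 : ∀ y k → count (suc y) (replicate k 0) ≡ 0
count-suc-replicate-0 y zero    = refl
count-suc-replicate-0 y (suc k) = count-suc-replicate-0 y k

majGo-zeros : ∀ c k → majGo 0 c (replicate k 0) ≡ replicate k 0
majGo-zeros c       zero    = refl
majGo-zeros zero    (suc k) = cong (0 ∷_) (majGo-zeros 1 k)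
majGo-zeros (suc c) (suc k) = cong (0 ∷_) (majGo-zeros (suc (suc c)) k)

Maj-wins : ℕ → Input
Maj-wins k = 1 ∷ 1 ∷ replicate (3 + k) 0

length-Maj-wins : ∀ k → length (Maj-wins k) ≡ 5 + k
length-Maj-wins k = cong (λ l → 2 + l) (List.length-replicate (3 + k))

countSum-Maj-Maj-wins : ∀ k → countSum (Maj-wins k) (Maj (Maj-wins k)) ≡ 8 + suc k * (3 + k)
countSum-Maj-Maj-wins k = begin
  countSum I (Maj I)                                ≡⟨ cong (λ r → countSum I (1 ∷ 1 ∷ 1 ∷ 1 ∷ 0 ∷ r)) (majGo-zeros 1 k) ⟩
  countSum I (1 ∷ 1 ∷ 1 ∷ 1 ∷ replicate (suc k) 0)  ≡⟨ cong₂ (λ u v → u + (u + (u + (u + v)))) c₁ (countSum-replicate I (suc k) 0) ⟩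
  8 + suc k * count 0 I                             ≡⟨ cong (λ c → 8 + suc k * c) (count-replicate-0 (3 + k)) ⟩
  8 + suc k * (3 + k)                               ∎
  where
  open ≡-Reasoning
  I = Maj-wins k
  c₁ : count 1 I ≡ 2
  c₁ = cong (λ c → 2 + c) (count-suc-replicate-0 0 (3 + k))

countSum-Eag-Maj-wins : ∀ k → countSum (Maj-wins k) (Eag (Maj-wins k)) ≡ (5 + k) * 2
countSum-Eag-Maj-wins k = begin
  countSum I (replicate (length I) 1)  ≡⟨ countSum-replicate I (length I) 1 ⟩
  length I * count 1 I                 ≡⟨ cong₂ _*_ (length-Maj-wins k) (cong (λ c → 2 + c) (count-suc-replicate-0 0 (3 + k))) ⟩
  (5 + k) * 2                          ∎
  where
  open ≡-Reasoning
  I = Maj-wins k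

[n-1]/n≤scaledDiff-Maj-wins : ∀ b t →
  (+ b ℤ.- + 0) / suc b ℚ.≤ scaledDiff Maj Eag (Maj-wins (8 * suc b + t))
[n-1]/n≤scaledDiff-Maj-wins b t = begin
  (+ b ℤ.- + 0) / suc b      ≤⟨ [a-b]/m≤[c-d]/n b 0 sm se cross ⟩
  (+ sm ℤ.- + se) / nn       ≡⟨ scaledDiff≡ Maj Eag I (length-Maj-wins k) ⟨
  scaledDiff Maj Eag I       ∎
  where
  open ℚP.≤-Reasoning
  k = 8 * suc b + t
  I = Maj-wins k
  sm = countSum I (Maj I)
  se = countSum I (Eag I)
  nn = (5 + k) * (5 + k)
  margin : ∀ b t → let k = 8 * suc b + t in
    b * ((5 + k) * (5 + k)) + (5 + k) * 2 * suc b + (81 + t * t + 56 * b + 18 * t + 8 * b * t)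
      ≡ (8 + suc k * (3 + k)) * suc b + 0 * ((5 + k) * (5 + k))
  margin = ℕ-Solver.solve-∀
  cross : b * nn + se * suc b ≤ sm * suc b + 0 * nn
  cross = subst₂ (λ e m → b * nn + e * suc b ≤ m * suc b + 0 * nn)
    (sym (countSum-Eag-Maj-wins k)) (sym (countSum-Maj-Maj-wins k)) (subst (b * nn + (5 + k) * 2 * suc b ≤_) (margin b t) (m≤m+n _ _))

alternating : ℕ → ℕ → Input
alternating d zero    = []
alternating d (suc j) = suc d ∷ 0 ∷ alternating (suc d) j

stutter : ℕ → ℕ → List Item
stutter d zero    = []
stutter d (suc j) = suc d ∷ suc d ∷ stutter (suc d) j

majGo-alternating : ∀ b d j → majGo b 0 (alternating d j) ≡ stutter d j
majGo-alternating b d zero    = refl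
majGo-alternating b d (suc j) = cong (λ r → suc d ∷ suc d ∷ r) (majGo-alternating (suc d) (suc d) j)

length-alternating : ∀ d j → length (alternating d j) ≡ j + j
length-alternating d zero    = refl
length-alternating d (suc j) = cong suc (trans (cong suc (length-alternating (suc d) j)) (sym (+-suc j j)))

count-0-alternating : ∀ d j → count 0 (alternating d j) ≡ j
count-0-alternating d zero    = refl
count-0-alternating d (suc j) = cong suc (count-0-alternating (suc d) j)

count-suc-alternating-fresh : ∀ {y d} j → y ℕ.< d → count (suc y) (alternating d j) ≡ 0
count-suc-alternating-fresh zero    y<d = refl
count-suc-alternating-fresh {y} {d} (suc j) y<d =
  trans (count-≢ (0 ∷ alternating (suc d) j) (λ y≡d → <-irrefl (suc-injective y≡d) y<d))
        (count-suc-alternating-fresh j (m≤n⇒m≤1+n y<d))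

count-suc-alternating≤1 : ∀ y d j → count (suc y) (alternating d j) ≤ 1
count-suc-alternating≤1 y d zero = z≤n
count-suc-alternating≤1 y d (suc j) with suc y ≟ suc d
... | yes y≡d = ≤-reflexive (trans (count-≡ (0 ∷ alternating (suc d) j) y≡d)
                  (cong suc (count-suc-alternating-fresh j (≤-reflexive (cong suc (suc-injective y≡d))))))
... | no  y≢d = ≤-trans (≤-reflexive (count-≢ (0 ∷ alternating (suc d) j) y≢d)) (count-suc-alternating≤1 y (suc d) j)

Eag-wins : ℕ → Input
Eag-wins j = 0 ∷ 0 ∷ 1 ∷ 2 ∷ alternating 2 j

length-Eag-wins : ∀ j → length (Eag-wins j) ≡ 4 + (j + j)
length-Eag-wins j = cong (λ l → 4 + l) (length-alternating 2 j)

count-suc-Eag-wins≤1 : ∀ j y → count (suc y) (Eag-wins j) ≤ 1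
count-suc-Eag-wins≤1 j zero          = ≤-reflexive (cong suc (count-suc-alternating-fresh j (s≤s z≤n)))
count-suc-Eag-wins≤1 j (suc zero)    = ≤-reflexive (cong suc (count-suc-alternating-fresh j ≤-refl))
count-suc-Eag-wins≤1 j (suc (suc y)) = count-suc-alternating≤1 (suc (suc y)) 2 j

countSum-stutter : ∀ I → (∀ y → count (suc y) I ≤ 1) → ∀ d j → countSum I (stutter d j) ≤ j + j
countSum-stutter I rare d zero    = z≤n
countSum-stutter I rare d (suc j) = subst (countSum I (stutter d (suc j)) ≤_) (cong suc (sym (+-suc j j)))
  (+-mono-≤ (rare d) (+-mono-≤ (rare d) (countSum-stutter I rare (suc d) j)))

count-0-Eag-wins : ∀ j → count 0 (Eag-wins j) ≡ 2 + j
count-0-Eag-wins j = cong (λ c → 2 + c) (count-0-alternating 2 j)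

countSum-Maj-Eag-wins : ∀ j →
  countSum (Eag-wins j) (Maj (Eag-wins j)) ≤ (2 + j) + ((2 + j) + ((2 + j) + ((2 + j) + (j + j))))
countSum-Maj-Eag-wins j = begin
  countSum I (Maj I)                             ≡⟨ cong (λ r → countSum I (0 ∷ 0 ∷ 0 ∷ 0 ∷ r)) (majGo-alternating 0 2 j) ⟩
  c + (c + (c + (c + countSum I (stutter 2 j)))) ≡⟨ cong (λ x → x + (x + (x + (x + countSum I (stutter 2 j))))) (count-0-Eag-wins j) ⟩
  c′ + (c′ + (c′ + (c′ + countSum I (stutter 2 j)))) ≤⟨ +-monoʳ-≤ c′ (+-monoʳ-≤ c′ (+-monoʳ-≤ c′ (+-monoʳ-≤ c′
                                                      (countSum-stutter I (count-suc-Eag-wins≤1 j) 2 j)))) ⟩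
  c′ + (c′ + (c′ + (c′ + (j + j))))              ∎
  where
  open ≤-Reasoning
  I = Eag-wins j
  c = count 0 I
  c′ = 2 + j

countSum-Eag-Eag-wins : ∀ j → countSum (Eag-wins j) (Eag (Eag-wins j)) ≡ (4 + (j + j)) * (2 + j)
countSum-Eag-Eag-wins j = begin
  countSum I (replicate (length I) 0)  ≡⟨ countSum-replicate I (length I) 0 ⟩
  length I * count 0 I                 ≡⟨ cong₂ _*_ (length-Eag-wins j) (count-0-Eag-wins j) ⟩
  (4 + (j + j)) * (2 + j)              ∎
  where
  open ≡-Reasoning
  I = Eag-wins j

scaledDiff-Eag-wins≤[2-n]/2n : ∀ b t →
  scaledDiff Maj Eag (Eag-wins (2 * suc b + t)) ℚ.≤ (+ 2 ℤ.- + suc b) / (suc b * 2)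
scaledDiff-Eag-wins≤[2-n]/2n b t = begin
  scaledDiff Maj Eag I       ≡⟨ scaledDiff≡ Maj Eag I (length-Eag-wins j) ⟩
  (+ sm ℤ.- + se) / nn       ≤⟨ [a-b]/m≤[c-d]/n sm se 2 (suc b) cross ⟩
  (+ 2 ℤ.- + suc b) / (suc b * 2) ∎
  where
  open ℚP.≤-Reasoning
  j = 2 * suc b + t
  I = Eag-wins j
  sm = countSum I (Maj I)
  se = countSum I (Eag I)
  n = 4 + (j + j)
  nn = n * n
  c = 2 + j
  sm′ = c + (c + (c + (c + (j + j))))
  margin : ∀ B t → let j = 2 * B + t ; c = 2 + j ; n = 4 + (j + j) in
    (c + (c + (c + (c + (j + j))))) * (B * 2) + B * (n * n)
      + (32 + 8 * B * B + 8 * t * t + 48 * B + 32 * t + 20 * B * t)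
      ≡ 2 * (n * n) + n * c * (B * 2)
  margin = ℕ-Solver.solve-∀
  cross : sm * (suc b * 2) + suc b * nn ≤ 2 * nn + se * (suc b * 2)
  cross = subst (λ e → sm * (suc b * 2) + suc b * nn ≤ 2 * nn + e * (suc b * 2)) (sym (countSum-Eag-Eag-wins j))
    (≤-trans (+-monoˡ-≤ (suc b * nn) (*-monoˡ-≤ (suc b * 2) (countSum-Maj-Eag-wins j)))
      (subst (sm′ * (suc b * 2) + suc b * nn ≤_) (margin (suc b) t) (m≤m+n _ _)))

p-ε≤p : ∀ p {ε} → Positive ε → p ℚ.- ε ℚ.≤ p
p-ε≤p p {ε} ε>0 = ℚP.≤-trans (ℚP.+-monoʳ-≤ p (ℚP.neg-antimono-≤ (ℚP.<⇒≤ (ℚP.positive⁻¹ ε {{ε>0}}))))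
                             (ℚP.≤-reflexive (ℚP.+-identityʳ p))

p≤p+ε : ∀ p {ε} → Positive ε → p ℚ.≤ p ℚ.+ ε
p≤p+ε p {ε} ε>0 = ℚP.≤-trans (ℚP.≤-reflexive (sym (ℚP.+-identityʳ p)))
                             (ℚP.+-monoʳ-≤ p (ℚP.<⇒≤ (ℚP.positive⁻¹ ε {{ε>0}})))

eventually-≥ : ∀ {A B L} → (∀ a as → L ℚ.≤ scaledDiff A B (a ∷ as)) →
  (ε : ℚ) → Positive ε → ∃[ N ] ((n : ℕ) → N ≤ n → (I : Input) → length I ≡ n → L ℚ.- ε ℚ.≤ scaledDiff A B I)
eventually-≥ {A} {B} {L} bound ε ε>0 = 1 , above
  where
  above : (n : ℕ) → 1 ≤ n → (I : Input) → length I ≡ n → L ℚ.- ε ℚ.≤ scaledDiff A B I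
  above .0 () [] refl
  above n 1≤n (a ∷ as) _ = ℚP.≤-trans (p-ε≤p L ε>0) (bound a as)

eventually-≤ : ∀ {A B L} → (∀ a as → scaledDiff A B (a ∷ as) ℚ.≤ L) →
  (ε : ℚ) → Positive ε → ∃[ N ] ((n : ℕ) → N ≤ n → (I : Input) → length I ≡ n → scaledDiff A B I ℚ.≤ L ℚ.+ ε)
eventually-≤ {A} {B} {L} bound ε ε>0 = 1 , below
  where
  below : (n : ℕ) → 1 ≤ n → (I : Input) → length I ≡ n → scaledDiff A B I ℚ.≤ L ℚ.+ ε
  below .0 () [] refl
  below n 1≤n (a ∷ as) _ = ℚP.≤-trans (bound a as) (p≤p+ε L ε>0)

Maj-wins-approaches-1 : (ε : ℚ) → Positive ε → (N : ℕ) →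
  ∃[ n ] (N ≤ n × ∃[ I ] (length I ≡ n × 1ℚ ℚ.- ε ℚ.≤ scaledDiff Maj Eag I))
Maj-wins-approaches-1 ε ε>0 N with positive⇒1/n≤ ε ε>0
... | b , 1/n≤ε = 5 + k , ≤-trans (m≤n+m N (8 * suc b)) (m≤n+m k 5) , Maj-wins k , length-Maj-wins k , (begin
  1ℚ ℚ.- ε                   ≤⟨ ℚP.+-monoʳ-≤ 1ℚ (ℚP.neg-antimono-≤ 1/n≤ε) ⟩
  1ℚ ℚ.- + 1 / suc b         ≡⟨ 1-1/n≡[n-1]/n b ⟩
  (+ b ℤ.- + 0) / suc b      ≤⟨ [n-1]/n≤scaledDiff-Maj-wins b N ⟩
  scaledDiff Maj Eag (Maj-wins k) ∎)
  where
  open ℚP.≤-Reasoning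
  k = 8 * suc b + N

Eag-wins-approaches-½ : (ε : ℚ) → Positive ε → (N : ℕ) →
  ∃[ n ] (N ≤ n × ∃[ I ] (length I ≡ n × scaledDiff Maj Eag I ℚ.≤ - ½ ℚ.+ ε))
Eag-wins-approaches-½ ε ε>0 N with positive⇒1/n≤ ε ε>0
... | b , 1/n≤ε = 4 + (j + j) , N≤n , Eag-wins j , length-Eag-wins j , (begin
  scaledDiff Maj Eag (Eag-wins j)  ≤⟨ scaledDiff-Eag-wins≤[2-n]/2n b N ⟩
  (+ 2 ℤ.- + suc b) / (suc b * 2)  ≡⟨ -½+1/n≡[2-n]/2n b ⟨
  - ½ ℚ.+ + 1 / suc b              ≤⟨ ℚP.+-monoʳ-≤ (- ½) 1/n≤ε ⟩
  - ½ ℚ.+ ε                        ∎)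
  where
  open ℚP.≤-Reasoning
  j = 2 * suc b + N
  N≤n : N ≤ 4 + (j + j)
  N≤n = ≤-trans (m≤n+m N (2 * suc b)) (≤-trans (m≤m+n j j) (m≤n+m (j + j) 4))

theorem7 : MinIs Maj Eag (- ½) × MaxIs Maj Eag 1ℚ
theorem7 = (eventually-≥ {Maj} {Eag} -½≤scaledDiff-Maj-Eag , Eag-wins-approaches-½)
         , (eventually-≤ {Maj} {Eag} scaledDiff-Maj-Eag≤1 , Maj-wins-approaches-1)
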